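{- For any $d,m\in\mathbb{N}$ and any integer $b\ge 2$, the number $a_{b,d}(m)$ of admissible patterns satisfies \[ a_{b,d}(m)\le (b!)^{m b^{m-1}(d-1)}. \]
   Context: An elementary interval in base $b$ is a box $E_{\boldsymbol c,\boldsymbol a}=\prod_{j=1}^d\left[\frac{a_j}{b^{c_j}},\frac{a_j+1}{b^{c_j}}\right)$ with $c_j,a_j\in\mathbb{N}_0$ and $0\le a_j<b^{c_j}$. A set $P$ of $b^m$ points in $[0,1)^d$ is a $(0,m,d)$-net in base $b$ if every elementary interval with $c_1+\cdots+c_d=m$ contains exactly one point of $P$. Partition $[0,1)^d$ into the $b^{md}$ sub-cubes $\prod_{j=1}^d[a_jb^{ -m},(a_j+1)b^{ -m})$, $0\le a_j<b^m$. An admissible pattern is a set of $b^m$ of these sub-cubes that is exactly the set of sub-cubes occupied by some $(0,m,d)$-net in base $b$ (equivalently, a set of $b^m$ sub-cubes such that every elementary interval with $c_1+\cdots+c_d=m$ contains exactly one of them; whether a point set is a $(0,m,d)$-net depends only on which sub-cubes its points occupy). $a_{b,d}(m)$ denotes the total number of admissible patterns. -}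

module Defs where

open import Data.Nat using (ℕ; zero; suc; _+_; _*_; _∸_; _^_; _≤_; _<_)

open import Data.Fin using (Fin; toℕ; remQuot)
import Data.Fin as Fin
open import Data.Fin.Subset using (Subset; _∈_; ∣_∣)
open import Data.Vec using (Vec; []; _∷_; lookup)
open import Data.Product using (_×_; _,_; Σ; ∃)
open import Relation.Binary.PropositionalEquality using (_≡_)

sumF : ∀ {d} → (Fin d → ℕ) → ℕ
sumF {zero}  c = 0
sumF {suc d} c = c Fin.zero + sumF (λ j → c (Fin.suc j))

-- The b^(m d) = (b^m)^d sub-cubes
-- prod_j [x_j b^-m, (x_j+1) b^-m) are indexed by Fin ((b ^ m) ^ d);
-- the index is decoded to its coordinate vector (x_1,…,x_d) by the
-- bijection Fin (B ^ d) ≅ Vec (Fin B) d built from remQuot.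
coords : ∀ {B} d → Fin (B ^ d) → Vec (Fin B) d
coords {B} zero    i = []
coords {B} (suc d) i with remQuot {B} (B ^ d) i
... | x , r = x ∷ coords d r

SubCube : (b m d : ℕ) → Set
SubCube b m d = Fin ((b ^ m) ^ d)

Pattern : (b m d : ℕ) → Set
Pattern b m d = Subset ((b ^ m) ^ d)

record ElemInterval (b m d : ℕ) : Set where
  field
    c      : Fin d → ℕ
    a      : Fin d → ℕ
    c-sum  : sumF c ≡ m
    a-bound : ∀ j → a j < b ^ c j

-- The sub-cube with coordinates x lies in E_{c,a} iff for every j
-- [x_j b^-m, (x_j+1) b^-m) ⊆ [a_j b^-c_j, (a_j+1) b^-c_j),
-- i.e. a_j b^(m-c_j) ≤ x_j and x_j + 1 ≤ (a_j+1) b^(m-c_j)  (c_j ≤ m here).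
_⊆E_ : ∀ {b m d} → SubCube b m d → ElemInterval b m d → Set
_⊆E_ {b} {m} {d} q E =
  ∀ j → (a j * b ^ (m ∸ c j) ≤ toℕ (lookup (coords d q) j))
      × (toℕ (lookup (coords d q) j) < suc (a j) * b ^ (m ∸ c j))
  where open ElemInterval E

ExactlyOne : ∀ {b m d} → Pattern b m d → ElemInterval b m d → Set
ExactlyOne {b} {m} {d} P E =
  Σ (SubCube b m d) (λ q → (q ∈ P) × (q ⊆E E)
    × (∀ q' → q' ∈ P → q' ⊆E E → q' ≡ q))

Admissible : (b m d : ℕ) → Pattern b m d → Set
Admissible b m d P =
  (∣ P ∣ ≡ b ^ m) × (∀ (E : ElemInterval b m d) → ExactlyOne P E)

-- An admissible pattern A meets every column {x₀ = x} (the elementary interval with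
-- c = (m, 0, …, 0)) in exactly one sub-cube, so A is the graph of d - 1 functions
-- f_j : [0, b^m) → [0, b^m) giving its remaining coordinates, and the elementary
-- intervals supported on the axes 0 and j say that x ↦ (x, f_j x) is a (0,m,2)-net.
-- In such a net fix a level v < m, the top m - 1 - v digits of x and the top v digits
-- of f x (b^(m-1) choices). Each value t of the next digit of x gives an elementary
-- interval with exactly one point, and the next digit σ(t) of f at that point depends
-- injectively on t: equal values would put both points into the interval fixing one
-- digit less of x and one more of f x. These m b^(m-1) permutations of the b digits
-- determine f digit by digit, so A is encoded injectively by (d-1) m b^(m-1) elements
-- of a set of size b!.
module Submission where

open import Defs
open import Data.Nat using (ℕ; zero; suc; _+_; _*_; _∸_; _^_; _≤_; _<_; _!; z≤n; s≤s; NonZero; >-nonZero; _/_; _%_; _≟_; _<?_)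
open import Data.Nat.Properties
open import Data.Nat.DivMod
open import Data.Fin using (Fin; zero; suc; toℕ; fromℕ<; combine; remQuot; punchOut; funToFin; finToFun)
open import Data.Fin.Properties as FinP using (toℕ<n; toℕ-injective; toℕ-fromℕ<; combine-injective; combine-remQuot; punchOut-injective; finToFun-funToFin; injective⇒≤)
open import Data.Product using (_×_; _,_; proj₁; proj₂; ∃-syntax; uncurry)
open import Function using (_∘_; const; _⇔_; mk⇔; Equivalence)
open import Data.Vec using (lookup)
open import Data.Fin.Subset using (_∈_; _⊆_)
open import Data.Fin.Subset.Properties using (⊆-antisym)
open import Data.Vec.Functional using (_∷_; updateAt)
open import Data.Vec.Functional.Properties using (updateAt-updates)
open import Function.Definitions using (Injective)
open import Relation.Binary.PropositionalEquality
open import Relation.Nullary.Decidable using (recompute)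

m/n≡o⇔o*n≤m<[1+o]*n : ∀ {m n o} .{{_ : NonZero n}} → m / n ≡ o ⇔ (o * n ≤ m × m < suc o * n)
m/n≡o⇔o*n≤m<[1+o]*n {m} {n} {o} = mk⇔ to from
  where
  to : m / n ≡ o → o * n ≤ m × m < suc o * n
  to refl = m/n*n≤m m n , (begin-strict
    m                  ≡⟨ m≡m%n+[m/n]*n m n ⟩
    m % n + m / n * n  <⟨ +-monoˡ-< (m / n * n) (m%n<n m n) ⟩
    n + m / n * n      ∎)
    where open ≤-Reasoning
  from : o * n ≤ m × m < suc o * n → m / n ≡ o
  from (lo , hi) = ≤-antisym (≤-pred (m<n*o⇒m/o<n hi))
    (subst (_≤ m / n) (m*n/n≡m o n) (/-monoˡ-≤ n lo))

m<p∧o<n⇒m*n+o<p*n : ∀ {m n o p} → m < p → o < n → m * n + o < p * n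
m<p∧o<n⇒m*n+o<p*n {m} {n} {o} {p} m<p o<n = begin-strict
  m * n + o  <⟨ +-monoʳ-< (m * n) o<n ⟩
  m * n + n  ≡⟨ +-comm (m * n) n ⟩
  suc m * n  ≤⟨ *-monoˡ-≤ n m<p ⟩
  p * n      ∎
  where open ≤-Reasoning

[m*n+o]/n≡m : ∀ m {n o} .{{_ : NonZero n}} → o < n → (m * n + o) / n ≡ m
[m*n+o]/n≡m m {n} {o} o<n = Equivalence.from m/n≡o⇔o*n≤m<[1+o]*n
  (m≤m+n (m * n) o , m<p∧o<n⇒m*n+o<p*n {m} ≤-refl o<n)

[m*n+o]%n≡o : ∀ m {n o} .{{_ : NonZero n}} → o < n → (m * n + o) % n ≡ o
[m*n+o]%n≡o m {n} {o} o<n = begin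
  (m * n + o) % n  ≡⟨ cong (_% n) (+-comm (m * n) o) ⟩
  (o + m * n) % n  ≡⟨ [m+kn]%n≡m%n o m n ⟩
  o % n            ≡⟨ m<n⇒m%n≡m o<n ⟩
  o                ∎
  where open ≡-Reasoning

funToFin-injective : ∀ {m n} {f g : Fin m → Fin n} → funToFin f ≡ funToFin g → ∀ i → f i ≡ g i
funToFin-injective {f = f} {g} eq i = begin
  f i                      ≡⟨ sym (finToFun-funToFin f i) ⟩
  finToFun (funToFin f) i  ≡⟨ cong (λ k → finToFun k i) eq ⟩
  finToFun (funToFin g) i  ≡⟨ finToFun-funToFin g i ⟩
  g i                      ∎
  where open ≡-Reasoning

remove₀ : ∀ {n} (σ : Fin (suc n) → Fin (suc n)) → Injective _≡_ _≡_ σ → Fin n → Fin n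
remove₀ σ σ-inj i = punchOut {i = σ zero} {σ (suc i)} (FinP.0≢1+n ∘ σ-inj)

remove₀-injective : ∀ {n} (σ : Fin (suc n) → Fin (suc n)) (σ-inj : Injective _≡_ _≡_ σ) →
                    Injective _≡_ _≡_ (remove₀ σ σ-inj)
remove₀-injective σ σ-inj eq = FinP.suc-injective (σ-inj (punchOut-injective {i = σ zero} _ _ eq))

-- The Lehmer code of an injective self-map of Fin n, read as a mixed-radix numeral.
lehmerCode : ∀ n (σ : Fin n → Fin n) → Injective _≡_ _≡_ σ → Fin (n !)
lehmerCode zero    σ σ-inj = zero
lehmerCode (suc n) σ σ-inj = combine (σ zero) (lehmerCode n (remove₀ σ σ-inj) (remove₀-injective σ σ-inj))

lehmerCode-injective : ∀ n {σ τ : Fin n → Fin n} (σ-inj : Injective _≡_ _≡_ σ) (τ-inj : Injective _≡_ _≡_ τ) →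
                       lehmerCode n σ σ-inj ≡ lehmerCode n τ τ-inj → ∀ i → σ i ≡ τ i
lehmerCode-injective (suc n) {σ} {τ} σ-inj τ-inj eq i
  with σ0≡τ0 , rest≡ ← combine-injective (σ zero) _ (τ zero) _ eq
  with i
... | zero  = σ0≡τ0
... | suc i = punchOut-injective′ σ0≡τ0 (lehmerCode-injective n _ _ rest≡ i)
  where
  punchOut-injective′ : ∀ {m} {i i' j j' : Fin (suc m)} {i≢j : i ≢ j} {i'≢j' : i' ≢ j'} →
                        i ≡ i' → punchOut i≢j ≡ punchOut i'≢j' → j ≡ j'
  punchOut-injective′ {i = i} refl = punchOut-injective {i = i} _ _

sumF-zero : ∀ {n} → sumF {n} (const 0) ≡ 0
sumF-zero {zero}  = refl
sumF-zero {suc n} = sumF-zero {n}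

single : ∀ {n} → Fin n → ℕ → Fin n → ℕ
single j v = updateAt (const 0) j (const v)

sumF-single : ∀ {n} (j : Fin n) v → sumF (single j v) ≡ v
sumF-single {suc n} zero    v = trans (cong (v +_) (sumF-zero {n})) (+-identityʳ v)
sumF-single         (suc j) v = sumF-single j v

single-pointwise : ∀ {n} (R : Fin n → ℕ → ℕ → Set) (j : Fin n) {v a} →
                   R j v a → (∀ i → R i 0 0) → ∀ i → R i (single j v i) (single j a i)
single-pointwise R zero    r r0 zero    = r
single-pointwise R zero    r r0 (suc i) = r0 (suc i)
single-pointwise R (suc j) r r0 zero    = r0 zero
single-pointwise R (suc j) r r0 (suc i) = single-pointwise (R ∘ suc) j r (r0 ∘ suc) i

single-self : ∀ {n} (R : Fin n → ℕ → ℕ → Set) (j : Fin n) {v a} →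
              R j (single j v j) (single j a j) → R j v a
single-self R j = subst₂ (R j) (updateAt-updates j (const 0)) (updateAt-updates j (const 0))

coords-injective : ∀ {B} d {q q' : Fin (B ^ d)} → (∀ i → lookup (coords d q) i ≡ lookup (coords d q') i) → q ≡ q'
coords-injective zero    {zero} {zero} _ = refl
coords-injective {B} (suc d) {q} {q'} eq = begin
  q                                        ≡⟨ sym (combine-remQuot {B} (B ^ d) q) ⟩
  uncurry combine (remQuot {B} (B ^ d) q)  ≡⟨ cong₂ combine (eq zero) (coords-injective d (eq ∘ suc)) ⟩
  uncurry combine (remQuot {B} (B ^ d) q') ≡⟨ combine-remQuot {B} (B ^ d) q' ⟩
  q'                                       ∎
  where open ≡-Reasoning

module _ (b : ℕ) .{{_ : NonZero b}} where

  b^n≢0 : ∀ n → NonZero (b ^ n)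
  b^n≢0 n = m^n≢0 b n

  -- Named, because instance search cannot find NonZero (b ^ k) for a variable k.
  infixl 7 _/b^_ _%b^_

  _/b^_ : ℕ → ℕ → ℕ
  y /b^ k = _/_ y (b ^ k) {{b^n≢0 k}}

  _%b^_ : ℕ → ℕ → ℕ
  y %b^ k = _%_ y (b ^ k) {{b^n≢0 k}}

  /b^≡⇔ : ∀ {y} k {a} → y /b^ k ≡ a ⇔ (a * b ^ k ≤ y × y < suc a * b ^ k)
  /b^≡⇔ k = m/n≡o⇔o*n≤m<[1+o]*n {{b^n≢0 k}}

  m/b^0≡m : ∀ y → y /b^ 0 ≡ y
  m/b^0≡m = n/1≡n

  m<b^k⇒m/b^k≡0 : ∀ {y} k → y < b ^ k → y /b^ k ≡ 0
  m<b^k⇒m/b^k≡0 k = m<n⇒m/n≡0 {{b^n≢0 k}}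

  m%b^k<b^k : ∀ y k → y %b^ k < b ^ k
  m%b^k<b^k y k = m%n<n y (b ^ k) {{b^n≢0 k}}

  [m*b^k+o]/b^k≡m : ∀ m k {o} → o < b ^ k → (m * b ^ k + o) /b^ k ≡ m
  [m*b^k+o]/b^k≡m m k = [m*n+o]/n≡m m {{b^n≢0 k}}

  [m*b^k+o]%b^k≡o : ∀ m k {o} → o < b ^ k → (m * b ^ k + o) %b^ k ≡ o
  [m*b^k+o]%b^k≡o m k = [m*n+o]%n≡o m {{b^n≢0 k}}

  m/b^[1+k]≡m/b^k/b : ∀ y k → y /b^ suc k ≡ y /b^ k / b
  m/b^[1+k]≡m/b^k/b y k = begin
    y /b^ suc k               ≡⟨ /-congʳ {{b^n≢0 (suc k)}} {{nz}} (*-comm b (b ^ k)) ⟩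
    _/_ y (b ^ k * b) {{nz}}  ≡⟨ sym (m/n/o≡m/[n*o] y (b ^ k) b {{b^n≢0 k}} {{_}} {{nz}}) ⟩
    y /b^ k / b               ∎
    where
    open ≡-Reasoning
    nz : NonZero (b ^ k * b)
    nz = m*n≢0 (b ^ k) b {{b^n≢0 k}}

  m/b^k≡m/b^[1+k]*b+m/b^k%b : ∀ y k → y /b^ k ≡ y /b^ suc k * b + y /b^ k % b
  m/b^k≡m/b^[1+k]*b+m/b^k%b y k = begin
    y /b^ k                            ≡⟨ m≡m%n+[m/n]*n (y /b^ k) b ⟩
    y /b^ k % b + y /b^ k / b * b      ≡⟨ +-comm (y /b^ k % b) _ ⟩
    y /b^ k / b * b + y /b^ k % b      ≡⟨ cong (λ z → z * b + y /b^ k % b) (sym (m/b^[1+k]≡m/b^k/b y k)) ⟩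
    y /b^ suc k * b + y /b^ k % b      ∎
    where open ≡-Reasoning

  m/b^k≡n*b+t⇒m/b^[1+k]≡n : ∀ {y} k {n t} → t < b → y /b^ k ≡ n * b + t → y /b^ suc k ≡ n
  m/b^k≡n*b+t⇒m/b^[1+k]≡n {y} k {n} {t} t<b eq = begin
    y /b^ suc k      ≡⟨ m/b^[1+k]≡m/b^k/b y k ⟩
    y /b^ k / b      ≡⟨ cong (_/ b) eq ⟩
    (n * b + t) / b  ≡⟨ [m*n+o]/n≡m n t<b ⟩
    n                ∎
    where open ≡-Reasoning

  m<b^[c+d]⇒m/b^d<b^c : ∀ {y} c d → y < b ^ (c + d) → y /b^ d < b ^ c
  m<b^[c+d]⇒m/b^d<b^c c d y< = m<n*o⇒m/o<n {{b^n≢0 d}} (subst (_ <_) (^-distribˡ-+-* b c d) y<)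

  -- The point set {(x, f x)} is a (0,m,2)-net in base b. The side conditions of cover are
  -- irrelevant so that the chosen points, and hence σ below, do not depend on their proofs.
  record IsNet₂ (m : ℕ) (f : Fin (b ^ m) → ℕ) : Set where
    field
      bounded  : ∀ x → f x < b ^ m
      cover    : ∀ c₀ c₁ P Q → .(c₀ + c₁ ≡ m) → .(P < b ^ c₀) → .(Q < b ^ c₁) →
                 ∃[ x ] (toℕ x /b^ c₁ ≡ P × f x /b^ c₀ ≡ Q)
      separate : ∀ c₀ c₁ → c₀ + c₁ ≡ m → ∀ {x y} →
                 toℕ x /b^ c₁ ≡ toℕ y /b^ c₁ → f x /b^ c₀ ≡ f y /b^ c₀ → x ≡ y

  module NetDigits {e : ℕ} {f : Fin (b ^ suc e) → ℕ} (N : IsNet₂ (suc e) f) where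
    open IsNet₂ N

    -- The context r < b ^ e packs the top u digits of x (as r /b^ v) and the top v digits
    -- of f x (as r %b^ v); t is one further digit of x.
    InCell : (u v r t : ℕ) → Fin (b ^ suc e) → Set
    InCell u v r t x = toℕ x /b^ v ≡ r /b^ v * b + t × f x /b^ suc u ≡ r %b^ v

    cell : ∀ u v → .(u + v ≡ e) → ∀ r → .(r < b ^ e) → ∀ t → .(t < b) → ∃[ x ] InCell u v r t x
    cell u v h r hr t ht = cover (suc u) v _ _ (cong suc h)
      (subst (r /b^ v * b + t <_) (*-comm (b ^ u) b)
        (m<p∧o<n⇒m*n+o<p*n (m<b^[c+d]⇒m/b^d<b^c u v (subst (r <_) (cong (b ^_) (sym h)) hr)) ht))
      (m%b^k<b^k r v)

    σ : ∀ u v → .(u + v ≡ e) → ∀ r → .(r < b ^ e) → ∀ t → .(t < b) → ℕ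
    σ u v h r hr t ht = f (proj₁ (cell u v h r hr t ht)) /b^ u % b

    σ-spec : ∀ u v (h : u + v ≡ e) {r} .(hr : r < b ^ e) {t} .(ht : t < b) {x} →
             InCell u v r t x → σ u v h r hr t ht ≡ f x /b^ u % b
    σ-spec u v h {r} hr {t} ht (x-prefix , fx-prefix) with cell u v h r hr t ht
    ... | w , w-prefix , fw-prefix = cong (λ z → f z /b^ u % b)
      (separate (suc u) v (cong suc h) (trans w-prefix (sym x-prefix)) (trans fw-prefix (sym fx-prefix)))

    -- Points with equal σ-values lie in the cell fixing one digit less of x and one more
    -- of f x, which holds only one point.
    σ-injective : ∀ u v (h : u + v ≡ e) {r} .(hr : r < b ^ e) {t t'} (ht : t < b) (ht' : t' < b) →
                  σ u v h r hr t ht ≡ σ u v h r hr t' ht' → t ≡ t'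
    σ-injective u v h {r} hr {t} {t'} ht ht' σt≡σt' = +-cancelˡ-≡ (r /b^ v * b) t t' (begin
      r /b^ v * b + t       ≡⟨ sym (proj₁ (in-cell ht)) ⟩
      toℕ (point ht) /b^ v  ≡⟨ cong (λ z → toℕ z /b^ v) point≡point' ⟩
      toℕ (point ht') /b^ v ≡⟨ proj₁ (in-cell ht') ⟩
      r /b^ v * b + t'      ∎)
      where
      open ≡-Reasoning
      point : ∀ {s} .(hs : s < b) → Fin (b ^ suc e)
      point {s} hs = proj₁ (cell u v h r hr s hs)
      in-cell : ∀ {s} .(hs : s < b) → InCell u v r s (point hs)
      in-cell {s} hs = proj₂ (cell u v h r hr s hs)
      x-prefix : ∀ {s} (hs : s < b) → toℕ (point hs) /b^ suc v ≡ r /b^ v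
      x-prefix hs = m/b^k≡n*b+t⇒m/b^[1+k]≡n v hs (proj₁ (in-cell hs))
      fx-prefix : ∀ {s} .(hs : s < b) → f (point hs) /b^ u ≡ r %b^ v * b + σ u v h r hr s hs
      fx-prefix {s} hs = trans (m/b^k≡m/b^[1+k]*b+m/b^k%b _ u) (cong (λ z → z * b + σ u v h r hr s hs) (proj₂ (in-cell hs)))
      point≡point' : point ht ≡ point ht'
      point≡point' = separate u (suc v) (trans (+-suc u v) (cong suc h))
        (trans (x-prefix ht) (sym (x-prefix ht')))
        (trans (fx-prefix ht) (trans (cong (r %b^ v * b +_) σt≡σt') (sym (fx-prefix ht'))))

    level-split : (l : Fin (suc e)) → e ∸ toℕ l + toℕ l ≡ e
    level-split l = m∸n+n≡m (FinP.toℕ≤pred[n] l)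

    σ-at : Fin (suc e) → Fin (b ^ e) → Fin b → ℕ
    σ-at l r t = σ (e ∸ toℕ l) (toℕ l) (level-split l) (toℕ r) (toℕ<n r) (toℕ t) (toℕ<n t)

    σ-at≡σ : ∀ l r t {u v r' t'} .(h : u + v ≡ e) .(hr : r' < b ^ e) .(ht : t' < b) →
             e ∸ toℕ l ≡ u → toℕ l ≡ v → toℕ r ≡ r' → toℕ t ≡ t' → σ-at l r t ≡ σ u v h r' hr t' ht
    σ-at≡σ l r t h hr ht refl refl refl refl = refl

    σ-table : Fin (suc e) → Fin (b ^ e) → Fin b → Fin b
    σ-table l r t = fromℕ< {σ-at l r t} (m%n<n _ b)

    σ-table-injective : ∀ l r → Injective _≡_ _≡_ (σ-table l r)
    σ-table-injective l r {t} {t'} eq = toℕ-injective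
      (σ-injective _ (toℕ l) (level-split l) (toℕ<n r) (toℕ<n t) (toℕ<n t')
        (FinP.fromℕ<-injective (σ-at l r t) (σ-at l r t') _ _ eq))

    σ-code : Fin (suc e) → Fin (b ^ e) → Fin (b !)
    σ-code l r = lehmerCode b (σ-table l r) (σ-table-injective l r)

    encode₂ : Fin (((b !) ^ (b ^ e)) ^ suc e)
    encode₂ = funToFin (funToFin ∘ σ-code)

  module _ {e : ℕ} {f g : Fin (b ^ suc e) → ℕ} (N : IsNet₂ (suc e) f) (M : IsNet₂ (suc e) g) where
    private
      module N = NetDigits N
      module M = NetDigits M

    σ-tables-agree : N.encode₂ ≡ M.encode₂ → ∀ l r t → N.σ-table l r t ≡ M.σ-table l r t
    σ-tables-agree eq l r = lehmerCode-injective b (N.σ-table-injective l r) (M.σ-table-injective l r)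
      (funToFin-injective {f = N.σ-code l} {M.σ-code l}
        (funToFin-injective {f = funToFin ∘ N.σ-code} {funToFin ∘ M.σ-code} eq l) r)

    σ-agree : N.encode₂ ≡ M.encode₂ →
              ∀ u v (h : u + v ≡ e) r .(hr : r < b ^ e) t .(ht : t < b) → N.σ u v h r hr t ht ≡ M.σ u v h r hr t ht
    σ-agree eq u v h r hr t ht = begin
      N.σ u v h r hr t ht      ≡⟨ N.σ-at≡σ l r' t' h hr ht u≡ v≡ r≡ t≡ ⟨
      N.σ-at l r' t'           ≡⟨ toℕ-fromℕ< (m%n<n _ b) ⟨
      toℕ (N.σ-table l r' t')  ≡⟨ cong toℕ (σ-tables-agree eq l r' t') ⟩
      toℕ (M.σ-table l r' t')  ≡⟨ toℕ-fromℕ< (m%n<n _ b) ⟩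
      M.σ-at l r' t'           ≡⟨ M.σ-at≡σ l r' t' h hr ht u≡ v≡ r≡ t≡ ⟩
      M.σ u v h r hr t ht      ∎
      where
      open ≡-Reasoning
      l : Fin (suc e)
      l = fromℕ< (s≤s (subst (v ≤_) h (m≤n+m v u)))
      r' : Fin (b ^ e)
      r' = fromℕ< hr
      t' : Fin b
      t' = fromℕ< ht
      v≡ : toℕ l ≡ v
      v≡ = toℕ-fromℕ< _
      u≡ : e ∸ toℕ l ≡ u
      u≡ = trans (cong₂ _∸_ (sym h) v≡) (m+n∸n≡m u v)
      r≡ : toℕ r' ≡ r
      r≡ = toℕ-fromℕ< hr
      t≡ : toℕ t' ≡ t
      t≡ = toℕ-fromℕ< ht

    digits-agree : N.encode₂ ≡ M.encode₂ → ∀ u v → u + v ≡ e → ∀ x →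
                   f x /b^ suc u ≡ g x /b^ suc u → f x /b^ u % b ≡ g x /b^ u % b
    digits-agree eq u v h x fx≡gx = begin
      f x /b^ u % b            ≡⟨ N.σ-spec u v h r<b^e t<b (x-prefix , fx-prefix) ⟨
      N.σ u v h r r<b^e t t<b  ≡⟨ σ-agree eq u v h r r<b^e t t<b ⟩
      M.σ u v h r r<b^e t t<b  ≡⟨ M.σ-spec u v h r<b^e t<b (x-prefix , trans (sym fx≡gx) fx-prefix) ⟩
      g x /b^ u % b            ∎
      where
      open ≡-Reasoning
      P Q r t : ℕ
      P = toℕ x /b^ suc v
      Q = f x /b^ suc u
      r = P * b ^ v + Q
      t = toℕ x /b^ v % b
      t<b : t < b
      t<b = m%n<n _ b
      Q<b^v : Q < b ^ v
      Q<b^v = m<b^[c+d]⇒m/b^d<b^c v (suc u)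
        (subst (f x <_) (cong (b ^_) (trans (cong suc (trans (sym h) (+-comm u v))) (sym (+-suc v u)))) (IsNet₂.bounded N x))
      r<b^e : r < b ^ e
      r<b^e = subst (r <_) (trans (sym (^-distribˡ-+-* b u v)) (cong (b ^_) h))
        (m<p∧o<n⇒m*n+o<p*n (m<b^[c+d]⇒m/b^d<b^c u (suc v)
          (subst (toℕ x <_) (cong (b ^_) (trans (cong suc (sym h)) (sym (+-suc u v)))) (toℕ<n x))) Q<b^v)
      x-prefix : toℕ x /b^ v ≡ r /b^ v * b + t
      x-prefix = trans (m/b^k≡m/b^[1+k]*b+m/b^k%b (toℕ x) v) (cong (λ z → z * b + t) (sym ([m*b^k+o]/b^k≡m P v Q<b^v)))
      fx-prefix : f x /b^ suc u ≡ r %b^ v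
      fx-prefix = sym ([m*b^k+o]%b^k≡o P v Q<b^v)

    prefixes-agree : N.encode₂ ≡ M.encode₂ → ∀ v u → u + v ≡ suc e → ∀ x → f x /b^ u ≡ g x /b^ u
    prefixes-agree eq zero u h x = begin
      f x /b^ u  ≡⟨ m<b^k⇒m/b^k≡0 u (subst (f x <_) (cong (b ^_) u≡) (IsNet₂.bounded N x)) ⟩
      0          ≡⟨ sym (m<b^k⇒m/b^k≡0 u (subst (g x <_) (cong (b ^_) u≡) (IsNet₂.bounded M x))) ⟩
      g x /b^ u  ∎
      where
      open ≡-Reasoning
      u≡ : suc e ≡ u
      u≡ = trans (sym h) (+-identityʳ u)
    prefixes-agree eq (suc v) u h x = begin
      f x /b^ u                          ≡⟨ m/b^k≡m/b^[1+k]*b+m/b^k%b (f x) u ⟩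
      f x /b^ suc u * b + f x /b^ u % b  ≡⟨ cong₂ (λ p d → p * b + d) higher (digits-agree eq u v (suc-injective h') x higher) ⟩
      g x /b^ suc u * b + g x /b^ u % b  ≡⟨ sym (m/b^k≡m/b^[1+k]*b+m/b^k%b (g x) u) ⟩
      g x /b^ u                          ∎
      where
      open ≡-Reasoning
      h' : suc u + v ≡ suc e
      h' = trans (sym (+-suc u v)) h
      higher : f x /b^ suc u ≡ g x /b^ suc u
      higher = prefixes-agree eq v (suc u) h' x

    encode₂-injective : N.encode₂ ≡ M.encode₂ → ∀ x → f x ≡ g x
    encode₂-injective eq x = begin
      f x        ≡⟨ sym (m/b^0≡m (f x)) ⟩
      f x /b^ 0  ≡⟨ prefixes-agree eq (suc e) 0 refl x ⟩
      g x /b^ 0  ≡⟨ m/b^0≡m (g x) ⟩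
      g x        ∎
      where open ≡-Reasoning

  module Cubes (m d : ℕ) where

    coord : SubCube b m d → Fin d → Fin (b ^ m)
    coord q = lookup (coords {b ^ m} d q)

    ⊆E⇔ : ∀ {q} (E : ElemInterval b m d) → q ⊆E E ⇔ (∀ j → toℕ (coord q j) /b^ (m ∸ ElemInterval.c E j) ≡ ElemInterval.a E j)
    ⊆E⇔ E = mk⇔ (λ q⊆E j → Equivalence.from (/b^≡⇔ (m ∸ c j)) (q⊆E j))
                (λ prefixes j → Equivalence.to (/b^≡⇔ (m ∸ c j)) (prefixes j))
      where open ElemInterval E

    coord/b^m≡0 : ∀ q j → toℕ (coord q j) /b^ m ≡ 0
    coord/b^m≡0 q j = m<b^k⇒m/b^k≡0 m (toℕ<n (coord q j))

  module Patterns (m d' : ℕ) where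
    open Cubes m (suc d')

    column : Fin (b ^ m) → ElemInterval b m (suc d')
    column x = record
      { c       = m ∷ const 0
      ; a       = toℕ x ∷ const 0
      ; c-sum   = trans (cong (m +_) (sumF-zero {d'})) (+-identityʳ m)
      ; a-bound = λ { zero → toℕ<n x ; (suc _) → s≤s z≤n }
      }

    ⊆column⇔ : ∀ {q x} → q ⊆E column x ⇔ coord q zero ≡ x
    ⊆column⇔ {q} {x} = mk⇔ to from
      where
      to : q ⊆E column x → coord q zero ≡ x
      to q⊆ = toℕ-injective (begin
        toℕ (coord q zero)              ≡⟨ sym (m/b^0≡m _) ⟩
        toℕ (coord q zero) /b^ 0        ≡⟨ cong (toℕ (coord q zero) /b^_) (sym (n∸n≡0 m)) ⟩
        toℕ (coord q zero) /b^ (m ∸ m)  ≡⟨ Equivalence.to (⊆E⇔ (column x)) q⊆ zero ⟩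
        toℕ x                           ∎)
        where open ≡-Reasoning
      from : coord q zero ≡ x → q ⊆E column x
      from refl = Equivalence.from (⊆E⇔ (column x)) λ
        { zero    → trans (cong (toℕ (coord q zero) /b^_) (n∸n≡0 m)) (m/b^0≡m _)
        ; (suc j) → coord/b^m≡0 q (suc j) }

    plane : Fin d' → ∀ c₀ c₁ P Q → .(c₀ + c₁ ≡ m) → .(P < b ^ c₀) → .(Q < b ^ c₁) → ElemInterval b m (suc d')
    plane j c₀ c₁ P Q h hP hQ = record
      { c       = c₀ ∷ single j c₁
      ; a       = P ∷ single j Q
      ; c-sum   = recompute (_ ≟ m) (trans (cong (c₀ +_) (sumF-single j c₁)) h)
      ; a-bound = λ
        { zero    → recompute (_ <? _) hP
        ; (suc i) → recompute (_ <? _) (single-pointwise (λ _ c a → a < b ^ c) j hQ (λ _ → s≤s z≤n) i) }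
      }

    ⊆plane⇔ : ∀ {j c₀ c₁ P Q} (h : c₀ + c₁ ≡ m) .(hP : P < b ^ c₀) .(hQ : Q < b ^ c₁) {q} →
              q ⊆E plane j c₀ c₁ P Q h hP hQ ⇔ (toℕ (coord q zero) /b^ c₁ ≡ P × toℕ (coord q (suc j)) /b^ c₀ ≡ Q)
    ⊆plane⇔ {j} {c₀} {c₁} {P} {Q} h hP hQ {q} = mk⇔ to from
      where
      m∸c₀≡c₁ : m ∸ c₀ ≡ c₁
      m∸c₀≡c₁ = trans (cong (_∸ c₀) (sym h)) (m+n∸m≡n c₀ c₁)
      m∸c₁≡c₀ : m ∸ c₁ ≡ c₀
      m∸c₁≡c₀ = trans (cong (_∸ c₁) (sym h)) (m+n∸n≡m c₀ c₁)
      InAxis : Fin d' → ℕ → ℕ → Set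
      InAxis i c a = toℕ (coord q (suc i)) /b^ (m ∸ c) ≡ a
      to : q ⊆E plane j c₀ c₁ P Q h hP hQ → toℕ (coord q zero) /b^ c₁ ≡ P × toℕ (coord q (suc j)) /b^ c₀ ≡ Q
      to q⊆ = subst (λ k → toℕ (coord q zero) /b^ k ≡ P) m∸c₀≡c₁ (prefixes zero)
            , subst (λ k → toℕ (coord q (suc j)) /b^ k ≡ Q) m∸c₁≡c₀ (single-self InAxis j (prefixes (suc j)))
        where
        open ElemInterval (plane j c₀ c₁ P Q h hP hQ)
        prefixes : ∀ i → toℕ (coord q i) /b^ (m ∸ c i) ≡ a i
        prefixes = Equivalence.to (⊆E⇔ (plane j c₀ c₁ P Q h hP hQ)) q⊆
      from : toℕ (coord q zero) /b^ c₁ ≡ P × toℕ (coord q (suc j)) /b^ c₀ ≡ Q → q ⊆E plane j c₀ c₁ P Q h hP hQ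
      from (x-prefix , y-prefix) = Equivalence.from (⊆E⇔ (plane j c₀ c₁ P Q h hP hQ)) λ
        { zero    → trans (cong (toℕ (coord q zero) /b^_) m∸c₀≡c₁) x-prefix
        ; (suc i) → single-pointwise InAxis j (trans (cong (toℕ (coord q (suc j)) /b^_) m∸c₁≡c₀) y-prefix)
                                     (λ i → coord/b^m≡0 q (suc i)) i }

    module Graph {A : Pattern b m (suc d')} (adm : Admissible b m (suc d') A) where

      point : ElemInterval b m (suc d') → SubCube b m (suc d')
      point E = proj₁ (proj₂ adm E)

      point-∈ : ∀ E → point E ∈ A
      point-∈ E = proj₁ (proj₂ (proj₂ adm E))

      point-⊆E : ∀ E → point E ⊆E E
      point-⊆E E = proj₁ (proj₂ (proj₂ (proj₂ adm E)))

      point-unique : ∀ E {q} → q ∈ A → q ⊆E E → q ≡ point E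
      point-unique E q∈A q⊆E = proj₂ (proj₂ (proj₂ (proj₂ adm E))) _ q∈A q⊆E

      point-column : ∀ {q} → q ∈ A → point (column (coord q zero)) ≡ q
      point-column q∈A = sym (point-unique (column _) q∈A (Equivalence.from ⊆column⇔ refl))

      coord-point-column : ∀ x → coord (point (column x)) zero ≡ x
      coord-point-column x = Equivalence.to ⊆column⇔ (point-⊆E (column x))

      graph : Fin d' → Fin (b ^ m) → ℕ
      graph j x = toℕ (coord (point (column x)) (suc j))

      graph-isNet₂ : ∀ j → IsNet₂ m (graph j)
      graph-isNet₂ j = record { bounded = λ _ → toℕ<n _ ; cover = cover ; separate = separate }
        where
        cover : ∀ c₀ c₁ P Q → .(c₀ + c₁ ≡ m) → .(P < b ^ c₀) → .(Q < b ^ c₁) →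
                ∃[ x ] (toℕ x /b^ c₁ ≡ P × graph j x /b^ c₀ ≡ Q)
        cover c₀ c₁ P Q h hP hQ = coord p zero
          , proj₁ p-prefixes , subst (λ z → toℕ (coord z (suc j)) /b^ c₀ ≡ Q) (sym (point-column (point-∈ E))) (proj₂ p-prefixes)
          where
          E : ElemInterval b m (suc d')
          E = plane j c₀ c₁ P Q h hP hQ
          p : SubCube b m (suc d')
          p = point E
          p-prefixes : toℕ (coord p zero) /b^ c₁ ≡ P × toℕ (coord p (suc j)) /b^ c₀ ≡ Q
          p-prefixes = Equivalence.to (⊆plane⇔ (recompute (_ ≟ m) h) hP hQ) (point-⊆E E)
        separate : ∀ c₀ c₁ → c₀ + c₁ ≡ m → ∀ {x y} →
                   toℕ x /b^ c₁ ≡ toℕ y /b^ c₁ → graph j x /b^ c₀ ≡ graph j y /b^ c₀ → x ≡ y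
        separate c₀ c₁ h {x} {y} x-prefix y-prefix = begin
          x                             ≡⟨ sym (coord-point-column x) ⟩
          coord (point (column x)) zero ≡⟨ cong (λ q → coord q zero) (point-unique E (point-∈ _) (in-E x refl refl)) ⟩
          coord (point E) zero          ≡⟨ cong (λ q → coord q zero) (point-unique E (point-∈ _) (in-E y (sym x-prefix) (sym y-prefix))) ⟨
          coord (point (column y)) zero ≡⟨ coord-point-column y ⟩
          y                             ∎
          where
          open ≡-Reasoning
          hP : toℕ x /b^ c₁ < b ^ c₀
          hP = m<b^[c+d]⇒m/b^d<b^c c₀ c₁ (subst (toℕ x <_) (cong (b ^_) (sym h)) (toℕ<n x))
          hQ : graph j x /b^ c₀ < b ^ c₁
          hQ = m<b^[c+d]⇒m/b^d<b^c c₁ c₀ (subst (graph j x <_) (cong (b ^_) (trans (sym h) (+-comm c₀ c₁))) (toℕ<n _))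
          E : ElemInterval b m (suc d')
          E = plane j c₀ c₁ (toℕ x /b^ c₁) (graph j x /b^ c₀) h hP hQ
          in-E : ∀ z → toℕ z /b^ c₁ ≡ toℕ x /b^ c₁ → graph j z /b^ c₀ ≡ graph j x /b^ c₀ → point (column z) ⊆E E
          in-E z z-prefix gz-prefix = Equivalence.from (⊆plane⇔ h hP hQ)
            (trans (cong (λ w → toℕ w /b^ c₁) (coord-point-column z)) z-prefix , gz-prefix)

    graphs-determine : ∀ {A A'} (adm : Admissible b m (suc d') A) (adm' : Admissible b m (suc d') A') →
                       (∀ j x → Graph.graph adm j x ≡ Graph.graph adm' j x) → A ⊆ A'
    graphs-determine {A' = A'} adm adm' same {q} q∈A = subst (_∈ A') q'≡q (G'.point-∈ _)
      where
      module G  = Graph adm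
      module G' = Graph adm'
      q'≡q : G'.point (column (coord q zero)) ≡ q
      q'≡q = coords-injective (suc d') λ
        { zero    → G'.coord-point-column _
        ; (suc j) → toℕ-injective (trans (sym (same j _)) (cong (λ z → toℕ (coord z (suc j))) (G.point-column q∈A))) }

  encode : ∀ {e d' A} → Admissible b (suc e) (suc d') A → Fin ((((b !) ^ (b ^ e)) ^ suc e) ^ d')
  encode {e} {d'} adm = funToFin (NetDigits.encode₂ ∘ Patterns.Graph.graph-isNet₂ (suc e) d' adm)

  encode-injective : ∀ {e d' A A'} (adm : Admissible b (suc e) (suc d') A) (adm' : Admissible b (suc e) (suc d') A') →
                     encode adm ≡ encode adm' → A ≡ A'
  encode-injective {e} {d'} adm adm' eq =
    ⊆-antisym (graphs-determine adm adm' same) (graphs-determine adm' adm (λ j x → sym (same j x)))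
    where
    open Patterns (suc e) d'
    same : ∀ j x → Graph.graph adm j x ≡ Graph.graph adm' j x
    same j = encode₂-injective (Graph.graph-isNet₂ adm j) (Graph.graph-isNet₂ adm' j)
      (funToFin-injective {f = NetDigits.encode₂ ∘ Graph.graph-isNet₂ adm} {NetDigits.encode₂ ∘ Graph.graph-isNet₂ adm'} eq j)

lemma3p2 : (b d m : ℕ) → 2 ≤ b → 1 ≤ d → 1 ≤ m →
    (k : ℕ) (f : Fin k → Pattern b m d) → Injective _≡_ _≡_ f →
    (∀ i → Admissible b m d (f i)) →
    k ≤ (b !) ^ (m * b ^ (m ∸ 1) * (d ∸ 1))
lemma3p2 b (suc d') (suc e) 2≤b _ _ k f f-inj adm = begin
  k                                        ≤⟨ injective⇒≤ {f = code} (f-inj ∘ encode-injective b (adm _) (adm _)) ⟩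
  (((b !) ^ (b ^ e)) ^ suc e) ^ d'         ≡⟨ cong (_^ d') (^-*-assoc (b !) (b ^ e) (suc e)) ⟩
  ((b !) ^ (b ^ e * suc e)) ^ d'           ≡⟨ ^-*-assoc (b !) (b ^ e * suc e) d' ⟩
  (b !) ^ (b ^ e * suc e * d')             ≡⟨ cong (λ z → (b !) ^ (z * d')) (*-comm (b ^ e) (suc e)) ⟩
  (b !) ^ (suc e * b ^ e * d')             ∎
  where
  open ≤-Reasoning
  instance
    b≢0 : NonZero b
    b≢0 = >-nonZero (≤-trans (s≤s z≤n) 2≤b)
  code : Fin k → Fin ((((b !) ^ (b ^ e)) ^ suc e) ^ d')
  code i = encode b (adm i)
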